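{- Let $v$ be a $tv$-valuation of a first-order language $\mathcal L$ and let $\mathcal L'\supseteq\mathcal L$ be a first-order language. Then there are a map $\Phi$ from the set of pure terms of $\mathcal L'$ onto the set of pure terms of $\mathcal L$ and a $tv$-valuation $v'$ of $\mathcal L'$ such that: (1) for every term $t$ of $\mathcal L$ with variables among $x_1,\dots,x_k$ and pure terms $r_1',\dots,r_k'$ of $\mathcal L'$, $\Phi(t\{x_1/r_1',\dots,x_k/r_k'\})=t\{x_1/\Phi(r_1'),\dots,x_k/\Phi(r_k')\}$; in particular $\Phi(t)=t$ for pure terms $t$ of $\mathcal L$; (2) for every formula $F$ of $\mathcal L$ with free variables among $x_1,\dots,x_k$ and pure terms $r_1',\dots,r_k'$ of $\mathcal L'$, $\bar{v'}(F\{x_1/r_1',\dots,x_k/r_k'\})=\bar v(F\{x_1/\Phi(r_1'),\dots,x_k/\Phi(r_k')\})$; in particular $\bar{v'}(F)=\bar v(F)$ for pure formulae $F$ of $\mathcal L$. Moreover, if $v$ is a $tv$-valuation with equality, then $v'$ can be taken to be a $tv$-valuation with equality.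
   Context: A first-order language has: a countable supply of variables (used for quantification), an infinite supply of individual parameters (free names that are never bound), constants, function symbols, relation symbols, the equality symbol $=$ and $\bot$; a larger language $\mathcal L'$ may contain additional parameters, constants, function and relation symbols. A term is pure if no variable occurs in it; a formula is pure if no variable occurs free in it. $F\{x/t\}$ denotes substitution; $\forall(\cdot)$ denotes universal closure. A $tv$-valuation of $\mathcal L$ is a total function $v$ from the pure atomic formulae of $\mathcal L$ to $\{\mathbf t,\mathbf f\}$ with $v(\bot)=\mathbf f$; it extends uniquely to $\bar v$ on pure formulae by the classical truth tables and: $\bar v(\forall x H)=\mathbf t$ iff $\bar v(H\{x/a\})=\mathbf t$ for every individual parameter $a$ of the language, $\bar v(\exists x H)=\mathbf t$ iff this holds for some parameter $a$. A $tv$-valuation with equality is a $tv$-valuation satisfying all sentences $\forall(t=t)$, $\forall(r=s\rightarrow s=r)$, $\forall(r=s\rightarrow(s=t\rightarrow r=t))$, $\forall(r_1=s_1\wedge\dots\wedge r_n=s_n\rightarrow(p(r_1,\dots,r_n)\rightarrow p(s_1,\dots,s_n)))$, $\forall(r_1=s_1\wedge\dots\wedge r_n=s_n\rightarrow f(r_1,\dots,r_n)=f(s_1,\dots,s_n))$ for all relation symbols $p$, function symbols $f$ and parameter-free terms; equivalently, $r=^v s:\iff v(r=s)=\mathbf t$ is a congruence on pure terms with respect to the function symbols and the relations determined by $v$. -}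

module Defs where

open import Data.Nat using (ℕ; zero; suc)
open import Data.Fin using (Fin; zero; suc)
open import Data.Vec using (Vec; []; _∷_; lookup)
open import Data.Bool using (Bool; true; false; not; _∧_; _∨_)
open import Data.Sum using (_⊎_; inj₁; inj₂)
open import Data.Sum.Properties using (inj₁-injective)
open import Data.Product using (Σ; _×_; _,_)
open import Function using (_∘_; _⇔_)
open import Function.Definitions using (Injective)
open import Relation.Binary.PropositionalEquality using (_≡_)

-- Variables are represented in the well-scoped (de Bruijn) style:
-- a term/formula in scope n has its free variables among n distinct
-- variables x₀,…,x_{n-1}; pure terms/formulae are those in scope 0.
-- Every language has an infinite supply of individual parameters
-- (witnessed by an injection ℕ → Par), constants, function symbols and
-- relation symbols (indexed by arity); = and ⊥ are logical symbols.

record Lang : Set₁ where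
  field
    Par       : Set
    Const     : Set
    Fun       : ℕ → Set
    Rel       : ℕ → Set
    parSeq    : ℕ → Par
    parSeq-inj : Injective _≡_ _≡_ parSeq

open Lang public

data Term (L : Lang) (n : ℕ) : Set where
  var : Fin n → Term L n
  par : Par L → Term L n
  con : Const L → Term L n
  app : ∀ {m} → Fun L m → Vec (Term L n) m → Term L n

infixr 6 _∧'_
infixr 5 _∨'_
infixr 4 _⇒'_
infix 7 _≐_

data Formula (L : Lang) (n : ℕ) : Set where
  rel   : ∀ {m} → Rel L m → Vec (Term L n) m → Formula L n
  _≐_   : Term L n → Term L n → Formula L n
  ⊥'    : Formula L n
  ¬'_   : Formula L n → Formula L n
  _∧'_  : Formula L n → Formula L n → Formula L n
  _∨'_  : Formula L n → Formula L n → Formula L n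
  _⇒'_  : Formula L n → Formula L n → Formula L n
  ∀'    : Formula L (suc n) → Formula L n
  ∃'    : Formula L (suc n) → Formula L n

mutual
  renT : ∀ {L n m} → (Fin n → Fin m) → Term L n → Term L m
  renT ρ (var i)    = var (ρ i)
  renT ρ (par a)    = par a
  renT ρ (con c)    = con c
  renT ρ (app f ts) = app f (renTs ρ ts)

  renTs : ∀ {L n m k} → (Fin n → Fin m) → Vec (Term L n) k → Vec (Term L m) k
  renTs ρ []       = []
  renTs ρ (t ∷ ts) = renT ρ t ∷ renTs ρ ts

mutual
  substT : ∀ {L n m} → (Fin n → Term L m) → Term L n → Term L m
  substT σ (var i)    = σ i
  substT σ (par a)    = par a
  substT σ (con c)    = con c
  substT σ (app f ts) = app f (substTs σ ts)

  substTs : ∀ {L n m k} → (Fin n → Term L m) → Vec (Term L n) k → Vec (Term L m) k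
  substTs σ []       = []
  substTs σ (t ∷ ts) = substT σ t ∷ substTs σ ts

liftS : ∀ {L n m} → (Fin n → Term L m) → Fin (suc n) → Term L (suc m)
liftS σ zero    = var zero
liftS σ (suc i) = renT suc (σ i)

substF : ∀ {L n m} → (Fin n → Term L m) → Formula L n → Formula L m
substF σ (rel p ts) = rel p (substTs σ ts)
substF σ (s ≐ t)    = substT σ s ≐ substT σ t
substF σ ⊥'         = ⊥'
substF σ (¬' F)     = ¬' substF σ F
substF σ (F ∧' G)   = substF σ F ∧' substF σ G
substF σ (F ∨' G)   = substF σ F ∨' substF σ G
substF σ (F ⇒' G)   = substF σ F ⇒' substF σ G
substF σ (∀' H)     = ∀' (substF (liftS σ) H)
substF σ (∃' H)     = ∃' (substF (liftS σ) H)

inst : ∀ {L} → Formula L 1 → Term L 0 → Formula L 0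
inst H t = substF (λ _ → t) H

data Atom (L : Lang) : Set where
  rel : ∀ {m} → Rel L m → Vec (Term L 0) m → Atom L
  eq  : Term L 0 → Term L 0 → Atom L
  bot : Atom L

record TV (L : Lang) : Set where
  field
    val   : Atom L → Bool
    val-⊥ : val bot ≡ false

open TV public

-- w is the (unique) extension v̄ of v to pure formulae
record IsExtension (L : Lang) (v : TV L) (w : Formula L 0 → Bool) : Set where
  field
    ext-rel : ∀ {m} (p : Rel L m) (ts : Vec (Term L 0) m) → w (rel p ts) ≡ val v (rel p ts)
    ext-eq  : ∀ (s t : Term L 0) → w (s ≐ t) ≡ val v (eq s t)
    ext-⊥   : w ⊥' ≡ val v bot
    ext-¬   : ∀ F → w (¬' F) ≡ not (w F)
    ext-∧   : ∀ F G → w (F ∧' G) ≡ (w F ∧ w G)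
    ext-∨   : ∀ F G → w (F ∨' G) ≡ (w F ∨ w G)
    ext-⇒   : ∀ F G → w (F ⇒' G) ≡ (not (w F) ∨ w G)
    ext-∀   : ∀ H → (w (∀' H) ≡ true) ⇔ (∀ (a : Par L) → w (inst H (par a)) ≡ true)
    ext-∃   : ∀ H → (w (∃' H) ≡ true) ⇔ Σ (Par L) (λ a → w (inst H (par a)) ≡ true)

_=[_]_ : ∀ {L} → Term L 0 → TV L → Term L 0 → Set
r =[ v ] s = val v (eq r s) ≡ true

record WithEquality (L : Lang) (v : TV L) : Set where
  field
    eq-refl  : ∀ (t : Term L 0) → t =[ v ] t
    eq-sym   : ∀ (r s : Term L 0) → r =[ v ] s → s =[ v ] r
    eq-trans : ∀ (r s t : Term L 0) → r =[ v ] s → s =[ v ] t → r =[ v ] t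
    eq-rel   : ∀ {m} (p : Rel L m) (rs ss : Vec (Term L 0) m) →
               (∀ i → lookup rs i =[ v ] lookup ss i) →
               val v (rel p rs) ≡ true → val v (rel p ss) ≡ true
    eq-fun   : ∀ {m} (f : Fun L m) (rs ss : Vec (Term L 0) m) →
               (∀ i → lookup rs i =[ v ] lookup ss i) →
               app f rs =[ v ] app f ss

-- Extensions L' ⊇ L: L' is L together with new symbols of each kind.

record NewSymbols : Set₁ where
  field
    NPar   : Set
    NConst : Set
    NFun   : ℕ → Set
    NRel   : ℕ → Set

open NewSymbols public

extend : Lang → NewSymbols → Lang
extend L E = record
  { Par        = Par L ⊎ NPar E
  ; Const      = Const L ⊎ NConst E
  ; Fun        = λ m → Fun L m ⊎ NFun E m
  ; Rel        = λ m → Rel L m ⊎ NRel E m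
  ; parSeq     = inj₁ ∘ parSeq L
  ; parSeq-inj = λ e → parSeq-inj L (inj₁-injective e)
  }

mutual
  embT : ∀ {L E n} → Term L n → Term (extend L E) n
  embT (var i)    = var i
  embT (par a)    = par (inj₁ a)
  embT (con c)    = con (inj₁ c)
  embT (app f ts) = app (inj₁ f) (embTs ts)

  embTs : ∀ {L E n k} → Vec (Term L n) k → Vec (Term (extend L E) n) k
  embTs []       = []
  embTs (t ∷ ts) = embT t ∷ embTs ts

embF : ∀ {L E n} → Formula L n → Formula (extend L E) n
embF (rel p ts) = rel (inj₁ p) (embTs ts)
embF (s ≐ t)    = embT s ≐ embT t
embF ⊥'         = ⊥'
embF (¬' F)     = ¬' embF F
embF (F ∧' G)   = embF F ∧' embF G
embF (F ∨' G)   = embF F ∨' embF G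
embF (F ⇒' G)   = embF F ⇒' embF G
embF (∀' H)     = ∀' (embF H)
embF (∃' H)     = ∃' (embF H)

-- The projection Φ erases the new symbols: a new parameter or constant, and any term
-- headed by a new function symbol, becomes one fixed parameter a₀ of L, and an atom
-- with a new relation symbol becomes ⊥. Φ commutes with substitution and is a left
-- inverse of the embedding, and v' is v read through Φ, so that v̄' = v̄ ∘ Φ. The
-- quantifier clauses survive because Φ maps the parameters of L' onto those of L, and
-- congruence survives because terms with a new head all go to a₀ and new relations are
-- constantly false.
module Submission where

open import Defs
open import Data.Nat using (ℕ; suc)
open import Data.Fin using (Fin; zero; suc)
open import Data.Vec using (Vec; []; _∷_; lookup)
open import Data.Bool using (Bool; true)
open import Data.Sum using (inj₁; inj₂)
open import Data.Product using (Σ; _×_; _,_)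
open import Function using (_∘_; _⇔_; mk⇔; Equivalence)
open import Relation.Binary.PropositionalEquality
  using (_≡_; refl; sym; trans; cong; cong₂; subst₂; module ≡-Reasoning)

mutual
  substT-cong : ∀ {L n m} {σ τ : Fin n → Term L m} → (∀ i → σ i ≡ τ i) →
                (t : Term L n) → substT σ t ≡ substT τ t
  substT-cong σ≗τ (var i)    = σ≗τ i
  substT-cong σ≗τ (par a)    = refl
  substT-cong σ≗τ (con c)    = refl
  substT-cong σ≗τ (app f ts) = cong (app f) (substTs-cong σ≗τ ts)

  substTs-cong : ∀ {L n m k} {σ τ : Fin n → Term L m} → (∀ i → σ i ≡ τ i) →
                 (ts : Vec (Term L n) k) → substTs σ ts ≡ substTs τ ts
  substTs-cong σ≗τ []       = refl
  substTs-cong σ≗τ (t ∷ ts) = cong₂ _∷_ (substT-cong σ≗τ t) (substTs-cong σ≗τ ts)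

liftS-cong : ∀ {L n m} {σ τ : Fin n → Term L m} → (∀ i → σ i ≡ τ i) →
             ∀ i → liftS σ i ≡ liftS τ i
liftS-cong σ≗τ zero    = refl
liftS-cong σ≗τ (suc i) = cong (renT suc) (σ≗τ i)

substF-cong : ∀ {L n m} {σ τ : Fin n → Term L m} → (∀ i → σ i ≡ τ i) →
              (F : Formula L n) → substF σ F ≡ substF τ F
substF-cong σ≗τ (rel p ts) = cong (rel p) (substTs-cong σ≗τ ts)
substF-cong σ≗τ (s ≐ t)    = cong₂ _≐_ (substT-cong σ≗τ s) (substT-cong σ≗τ t)
substF-cong σ≗τ ⊥'         = refl
substF-cong σ≗τ (¬' F)     = cong ¬'_ (substF-cong σ≗τ F)
substF-cong σ≗τ (F ∧' G)   = cong₂ _∧'_ (substF-cong σ≗τ F) (substF-cong σ≗τ G)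
substF-cong σ≗τ (F ∨' G)   = cong₂ _∨'_ (substF-cong σ≗τ F) (substF-cong σ≗τ G)
substF-cong σ≗τ (F ⇒' G)   = cong₂ _⇒'_ (substF-cong σ≗τ F) (substF-cong σ≗τ G)
substF-cong σ≗τ (∀' H)     = cong ∀' (substF-cong (liftS-cong σ≗τ) H)
substF-cong σ≗τ (∃' H)     = cong ∃' (substF-cong (liftS-cong σ≗τ) H)

module Projection {L : Lang} {E : NewSymbols} (a₀ : Par L) where

  L' : Lang
  L' = extend L E

  projPar : Par L' → Par L
  projPar (inj₁ a) = a
  projPar (inj₂ _) = a₀

  mutual
    projT : ∀ {n} → Term L' n → Term L n
    projT (var i)           = var i
    projT (par a)           = par (projPar a)
    projT (con (inj₁ c))    = con c
    projT (con (inj₂ _))    = par a₀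
    projT (app (inj₁ f) ts) = app f (projTs ts)
    projT (app (inj₂ _) ts) = par a₀

    projTs : ∀ {n k} → Vec (Term L' n) k → Vec (Term L n) k
    projTs []       = []
    projTs (t ∷ ts) = projT t ∷ projTs ts

  projF : ∀ {n} → Formula L' n → Formula L n
  projF (rel (inj₁ p) ts) = rel p (projTs ts)
  projF (rel (inj₂ _) ts) = ⊥'
  projF (s ≐ t)           = projT s ≐ projT t
  projF ⊥'                = ⊥'
  projF (¬' F)            = ¬' projF F
  projF (F ∧' G)          = projF F ∧' projF G
  projF (F ∨' G)          = projF F ∨' projF G
  projF (F ⇒' G)          = projF F ⇒' projF G
  projF (∀' H)            = ∀' (projF H)
  projF (∃' H)            = ∃' (projF H)

  lookup-projTs : ∀ {n k} (ts : Vec (Term L' n) k) i → lookup (projTs ts) i ≡ projT (lookup ts i)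
  lookup-projTs (t ∷ ts) zero    = refl
  lookup-projTs (t ∷ ts) (suc i) = lookup-projTs ts i

  mutual
    projT-renT : ∀ {n m} (ρ : Fin n → Fin m) (t : Term L' n) → projT (renT ρ t) ≡ renT ρ (projT t)
    projT-renT ρ (var i)           = refl
    projT-renT ρ (par a)           = refl
    projT-renT ρ (con (inj₁ c))    = refl
    projT-renT ρ (con (inj₂ _))    = refl
    projT-renT ρ (app (inj₁ f) ts) = cong (app f) (projTs-renTs ρ ts)
    projT-renT ρ (app (inj₂ _) ts) = refl

    projTs-renTs : ∀ {n m k} (ρ : Fin n → Fin m) (ts : Vec (Term L' n) k) →
                   projTs (renTs ρ ts) ≡ renTs ρ (projTs ts)
    projTs-renTs ρ []       = refl
    projTs-renTs ρ (t ∷ ts) = cong₂ _∷_ (projT-renT ρ t) (projTs-renTs ρ ts)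

  mutual
    projT-substT : ∀ {n m} (σ : Fin n → Term L' m) (t : Term L' n) →
                   projT (substT σ t) ≡ substT (projT ∘ σ) (projT t)
    projT-substT σ (var i)           = refl
    projT-substT σ (par a)           = refl
    projT-substT σ (con (inj₁ c))    = refl
    projT-substT σ (con (inj₂ _))    = refl
    projT-substT σ (app (inj₁ f) ts) = cong (app f) (projTs-substTs σ ts)
    projT-substT σ (app (inj₂ _) ts) = refl

    projTs-substTs : ∀ {n m k} (σ : Fin n → Term L' m) (ts : Vec (Term L' n) k) →
                     projTs (substTs σ ts) ≡ substTs (projT ∘ σ) (projTs ts)
    projTs-substTs σ []       = refl
    projTs-substTs σ (t ∷ ts) = cong₂ _∷_ (projT-substT σ t) (projTs-substTs σ ts)

  projT-liftS : ∀ {n m} (σ : Fin n → Term L' m) i → projT (liftS σ i) ≡ liftS (projT ∘ σ) i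
  projT-liftS σ zero    = refl
  projT-liftS σ (suc i) = projT-renT suc (σ i)

  mutual
    projF-substF : ∀ {n m} (σ : Fin n → Term L' m) (F : Formula L' n) →
                   projF (substF σ F) ≡ substF (projT ∘ σ) (projF F)
    projF-substF σ (rel (inj₁ p) ts) = cong (rel p) (projTs-substTs σ ts)
    projF-substF σ (rel (inj₂ _) ts) = refl
    projF-substF σ (s ≐ t)           = cong₂ _≐_ (projT-substT σ s) (projT-substT σ t)
    projF-substF σ ⊥'                = refl
    projF-substF σ (¬' F)            = cong ¬'_ (projF-substF σ F)
    projF-substF σ (F ∧' G)          = cong₂ _∧'_ (projF-substF σ F) (projF-substF σ G)
    projF-substF σ (F ∨' G)          = cong₂ _∨'_ (projF-substF σ F) (projF-substF σ G)
    projF-substF σ (F ⇒' G)          = cong₂ _⇒'_ (projF-substF σ F) (projF-substF σ G)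
    projF-substF σ (∀' H)            = cong ∀' (projF-substF-liftS σ H)
    projF-substF σ (∃' H)            = cong ∃' (projF-substF-liftS σ H)

    projF-substF-liftS : ∀ {n m} (σ : Fin n → Term L' m) (H : Formula L' (suc n)) →
                         projF (substF (liftS σ) H) ≡ substF (liftS (projT ∘ σ)) (projF H)
    projF-substF-liftS σ H =
      trans (projF-substF (liftS σ) H) (substF-cong (projT-liftS σ) (projF H))

  projF-inst : (H : Formula L' 1) (a : Par L') →
               projF (inst H (par a)) ≡ inst (projF H) (par (projPar a))
  projF-inst H a = projF-substF (λ _ → par a) H

  mutual
    projT-embT : ∀ {n} (t : Term L n) → projT (embT t) ≡ t
    projT-embT (var i)    = refl
    projT-embT (par a)    = refl
    projT-embT (con c)    = refl
    projT-embT (app f ts) = cong (app f) (projTs-embTs ts)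

    projTs-embTs : ∀ {n k} (ts : Vec (Term L n) k) → projTs (embTs ts) ≡ ts
    projTs-embTs []       = refl
    projTs-embTs (t ∷ ts) = cong₂ _∷_ (projT-embT t) (projTs-embTs ts)

  projF-embF : ∀ {n} (F : Formula L n) → projF (embF F) ≡ F
  projF-embF (rel p ts) = cong (rel p) (projTs-embTs ts)
  projF-embF (s ≐ t)    = cong₂ _≐_ (projT-embT s) (projT-embT t)
  projF-embF ⊥'         = refl
  projF-embF (¬' F)     = cong ¬'_ (projF-embF F)
  projF-embF (F ∧' G)   = cong₂ _∧'_ (projF-embF F) (projF-embF G)
  projF-embF (F ∨' G)   = cong₂ _∨'_ (projF-embF F) (projF-embF G)
  projF-embF (F ⇒' G)   = cong₂ _⇒'_ (projF-embF F) (projF-embF G)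
  projF-embF (∀' H)     = cong ∀' (projF-embF H)
  projF-embF (∃' H)     = cong ∃' (projF-embF H)

  projT-substT-embT : ∀ {k} (t : Term L k) (σ : Fin k → Term L' 0) →
                      projT (substT σ (embT t)) ≡ substT (projT ∘ σ) t
  projT-substT-embT t σ = begin
    projT (substT σ (embT t))             ≡⟨ projT-substT σ (embT t) ⟩
    substT (projT ∘ σ) (projT (embT t))   ≡⟨ cong (substT (projT ∘ σ)) (projT-embT t) ⟩
    substT (projT ∘ σ) t                  ∎
    where open ≡-Reasoning

  projF-substF-embF : ∀ {k} (F : Formula L k) (σ : Fin k → Term L' 0) →
                      projF (substF σ (embF F)) ≡ substF (projT ∘ σ) F
  projF-substF-embF F σ = begin
    projF (substF σ (embF F))             ≡⟨ projF-substF σ (embF F) ⟩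
    substF (projT ∘ σ) (projF (embF F))   ≡⟨ cong (substF (projT ∘ σ)) (projF-embF F) ⟩
    substF (projT ∘ σ) F                  ∎
    where open ≡-Reasoning

module Pullback {L : Lang} (E : NewSymbols) (a₀ : Par L)
                (v : TV L) (vbar : Formula L 0 → Bool) (ext : IsExtension L v vbar) where

  open Projection {L} {E} a₀
  open IsExtension ext

  vbar' : Formula L' 0 → Bool
  vbar' = vbar ∘ projF

  atomF : Atom L' → Formula L' 0
  atomF (rel p ts) = rel p ts
  atomF (eq s t)   = s ≐ t
  atomF bot        = ⊥'

  v' : TV L'
  v' = record { val = vbar' ∘ atomF ; val-⊥ = trans ext-⊥ (val-⊥ v) }

  vbar'-inst : (H : Formula L' 1) (a : Par L') →
               vbar' (inst H (par a)) ≡ vbar (inst (projF H) (par (projPar a)))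
  vbar'-inst H a = cong vbar (projF-inst H a)

  isExtension : IsExtension L' v' vbar'
  isExtension = record
    { ext-rel = λ p ts → refl
    ; ext-eq  = λ s t → refl
    ; ext-⊥   = refl
    ; ext-¬   = λ F → ext-¬ (projF F)
    ; ext-∧   = λ F G → ext-∧ (projF F) (projF G)
    ; ext-∨   = λ F G → ext-∨ (projF F) (projF G)
    ; ext-⇒   = λ F G → ext-⇒ (projF F) (projF G)
    ; ext-∀   = λ H → mk⇔
        (λ all a → trans (vbar'-inst H a) (Equivalence.to (ext-∀ (projF H)) all (projPar a)))
        (λ all → Equivalence.from (ext-∀ (projF H))
                   (λ a → trans (sym (vbar'-inst H (inj₁ a))) (all (inj₁ a))))
    ; ext-∃   = λ H → mk⇔
        (λ some → let (a , holds) = Equivalence.to (ext-∃ (projF H)) some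
                  in inj₁ a , trans (vbar'-inst H (inj₁ a)) holds)
        (λ { (a , holds) → Equivalence.from (ext-∃ (projF H))
                             (projPar a , trans (sym (vbar'-inst H a)) holds) })
    }

  =-pullback : ∀ (r s : Term L' 0) → r =[ v' ] s ⇔ projT r =[ v ] projT s
  =-pullback r s = mk⇔ (trans (sym (ext-eq (projT r) (projT s))))
                       (trans (ext-eq (projT r) (projT s)))

  withEquality : WithEquality L v → WithEquality L' v'
  withEquality W = record
    { eq-refl  = λ t → from (=-pullback t t) (eq-refl (projT t))
    ; eq-sym   = λ r s r=s → from (=-pullback s r) (eq-sym _ _ (to (=-pullback r s) r=s))
    ; eq-trans = λ r s t r=s s=t →
        from (=-pullback r t) (eq-trans _ _ _ (to (=-pullback r s) r=s) (to (=-pullback s t) s=t))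
    ; eq-rel   = eq-rel'
    ; eq-fun   = eq-fun'
    }
    where
    open WithEquality W
    open Equivalence

    projTs-pointwise : ∀ {m} (rs ss : Vec (Term L' 0) m) →
                       (∀ i → lookup rs i =[ v' ] lookup ss i) →
                       ∀ i → lookup (projTs rs) i =[ v ] lookup (projTs ss) i
    projTs-pointwise rs ss rs=ss i =
      subst₂ (λ r s → r =[ v ] s) (sym (lookup-projTs rs i)) (sym (lookup-projTs ss i))
             (to (=-pullback _ _) (rs=ss i))

    eq-rel' : ∀ {m} (p : Rel L' m) (rs ss : Vec (Term L' 0) m) →
              (∀ i → lookup rs i =[ v' ] lookup ss i) →
              val v' (rel p rs) ≡ true → val v' (rel p ss) ≡ true
    eq-rel' (inj₁ p) rs ss rs=ss holds =
      trans (ext-rel p (projTs ss))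
            (eq-rel p _ _ (projTs-pointwise rs ss rs=ss) (trans (sym (ext-rel p (projTs rs))) holds))
    eq-rel' (inj₂ p) rs ss rs=ss holds = holds

    eq-fun' : ∀ {m} (f : Fun L' m) (rs ss : Vec (Term L' 0) m) →
              (∀ i → lookup rs i =[ v' ] lookup ss i) → app f rs =[ v' ] app f ss
    eq-fun' (inj₁ f) rs ss rs=ss =
      from (=-pullback (app (inj₁ f) rs) (app (inj₁ f) ss)) (eq-fun f _ _ (projTs-pointwise rs ss rs=ss))
    eq-fun' (inj₂ f) rs ss rs=ss =
      from (=-pullback (app (inj₂ f) rs) (app (inj₂ f) ss)) (eq-refl (par a₀))

mainTheorem6 : (L : Lang) (E : NewSymbols) (v : TV L) (vbar : Formula L 0 → Bool) →
    IsExtension L v vbar →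
    Σ (Term (extend L E) 0 → Term L 0) λ Φ →
    Σ (TV (extend L E)) λ v' →
    Σ (Formula (extend L E) 0 → Bool) λ vbar' →
      IsExtension (extend L E) v' vbar'
      × (∀ (t : Term L 0) → Σ (Term (extend L E) 0) λ t' → Φ t' ≡ t)
      × (∀ (k : ℕ) (t : Term L k) (σ : Fin k → Term (extend L E) 0) →
           Φ (substT σ (embT t)) ≡ substT (Φ ∘ σ) t)
      × (∀ (t : Term L 0) → Φ (embT t) ≡ t)
      × (∀ (k : ℕ) (F : Formula L k) (σ : Fin k → Term (extend L E) 0) →
           vbar' (substF σ (embF F)) ≡ vbar (substF (Φ ∘ σ) F))
      × (∀ (F : Formula L 0) → vbar' (embF F) ≡ vbar F)
      × (WithEquality L v → WithEquality (extend L E) v')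
mainTheorem6 L E v vbar ext =
  projT , v' , vbar' , isExtension
  , (λ t → embT t , projT-embT t)
  , (λ k → projT-substT-embT)
  , projT-embT
  , (λ k F σ → cong vbar (projF-substF-embF F σ))
  , (λ F → cong vbar (projF-embF F))
  , withEquality
  where
  a₀ : Par L
  a₀ = parSeq L 0
  open Projection {L} {E} a₀
  open Pullback E a₀ v vbar ext
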